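{- For every $d>0$, any triangle-free graph on $n$ vertices with minimum degree at least $d$ has list chromatic number at most $\lceil (n\log n)/d\rceil$.
   Context: $\log$ is the natural logarithm.
   Formalization: The parameter $d$ ranges over the positive rationals. -}

module Defs where

open import Data.Nat using (ℕ; zero; suc; _+_; _*_; _^_; _≤_; _<_; _!)
open import Data.Nat.ListAction using (sum)
open import Data.Bool using (Bool; true; false; if_then_else_)
open import Data.Fin using (Fin)

open import Data.List using (List; length; map; allFin)
open import Data.List.Membership.Propositional using (_∈_)
open import Data.List.Relation.Unary.Unique.Propositional using (Unique)
open import Data.Product using (Σ; ∃; _×_)
open import Data.Empty using (⊥)
open import Relation.Nullary using (¬_)
open import Relation.Binary.PropositionalEquality using (_≡_; _≢_)

record Graph (n : ℕ) : Set where
  field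
    adj   : Fin n → Fin n → Bool
    sym   : ∀ u v → adj u v ≡ adj v u
    irref : ∀ v → adj v v ≡ false

open Graph public

degree : ∀ {n} → Graph n → Fin n → ℕ
degree {n} G v = sum (map (λ u → if adj G v u then 1 else 0) (allFin n))

TriangleFree : ∀ {n} → Graph n → Set
TriangleFree {n} G =
  (u v w : Fin n) → adj G u v ≡ true → adj G v w ≡ true → adj G u w ≡ true → ⊥

Choosable : ∀ {n} → Graph n → ℕ → Set
Choosable {n} G k =
  (L : Fin n → List ℕ) → ((v : Fin n) → (length (L v) ≡ k) × Unique (L v)) →
  Σ (Fin n → ℕ) λ c →
    ((v : Fin n) → c v ∈ L v) ×
    ((u v : Fin n) → adj G u v ≡ true → c u ≢ c v)

ListChromaticAtMost : ∀ {n} → Graph n → ℕ → Set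
ListChromaticAtMost G k = Choosable G k

-- expPartial m J = J! * Σ_{j=0}^{J} m^j / j!   (a natural number)
expPartial : ℕ → ℕ → ℕ
expPartial m zero    = 1
expPartial m (suc J) = suc J * expPartial m J + m ^ suc J

-- ExpGe m N  ⟺  e^m ≥ N  (exact: e^m is the supremum of its partial sums,
-- and for m > 0 it is irrational, while e^0 = 1 is the J = 0 partial sum).
ExpGe : ℕ → ℕ → Set
ExpGe m N = ∃ λ J → N * (J !) ≤ expPartial m J

-- CeilLogBound n p q k  ⟺  k = ⌈ (n log n) / d ⌉  where d = p / q.
-- Indeed k ≥ (n ln n)·q/p  ⟺  k·p ≥ q·n·ln n  ⟺  e^(k·p) ≥ n^(q·n),
-- and the ceiling is the least such natural number k.
CeilLogBound : ℕ → ℕ → ℕ → ℕ → Set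
CeilLogBound n p q k =
  ExpGe (k * p) (n ^ (q * n)) ×
  ((j : ℕ) → j < k → ¬ ExpGe (j * p) (n ^ (q * n)))

-- minimum degree of G is at least d = p / q
MinDegreeAtLeast : ∀ {n} → Graph n → ℕ → ℕ → Set
MinDegreeAtLeast {n} G p q = (v : Fin n) → p ≤ q * degree G v

-- Give every colour c a centre x c and colour u by c when c ∈ L u and x c is adjacent
-- to u.  Neighbourhoods in a triangle-free graph are independent sets, so this is a
-- proper L-colouring as soon as every vertex receives some colour.  A uniformly random
-- centre is adjacent to u with probability at least d/n, so the expected number of
-- uncoloured vertices is at most n (1 - d/n)^k < n e^(-dk/n) ≤ 1, and the method of
-- conditional expectations, applied one colour at a time, finds centres leaving no
-- vertex uncoloured.
--
-- In ℕ, with a = qn and s = a - p, the bound n (1 - d/n)^k < 1 reads n s^k < a^k.  Put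
-- N = ka and t = p/a, so that kp = Nt.  Raised to the power a, the bound becomes
-- n^a (1 - t)^N < 1, and ExpGe gives n^a ≤ Σ_(j≤J) (Nt)^j/j! for some J.  As
-- N^j/j! ≤ C(N+j-1, j), this sum is at most Σ_(j≤J) C(N+j-1, j) t^j, a partial sum of
-- the series of (1 - t)^(-N) with positive terms omitted, so (1 - t)^N times it is < 1.

module Submission where

open import Defs hiding (sym)
open import Data.Nat
  using (ℕ; zero; suc; _+_; _*_; _^_; _∸_; _≤_; _<_; _!; _≟_; z≤n; s≤s; NonZero; >-nonZero; >-nonZero⁻¹)
open import Data.Nat.Properties
open import Data.Nat.Tactic.RingSolver using (solve-∀)
open import Algebra.Properties.CommutativeSemigroup *-commutativeSemigroup
  using (x∙yz≈y∙xz; x∙yz≈yx∙z; x∙yz≈z∙xy; x∙yz≈z∙yx; xy∙z≈xz∙y; interchange)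
open import Algebra.Properties.Semiring.Sum +-*-semiring
  using (sum-syntax; sum-cong-≗; ∑-distrib-+; ∑-comm; *-distribˡ-sum; *-distribʳ-sum)
import Data.Nat.ListAction as ListAction
open import Data.Bool using (Bool; true; false; if_then_else_)
open import Data.Fin using (Fin; zero; suc; fromℕ<)
open import Data.List using (List; []; _∷_; length; filter; tabulate; allFin; concatMap)
import Data.List as List
open import Data.List.Properties using (map-tabulate; filter-all; filter-reject; filter-accept)
open import Data.List.Membership.Propositional using (_∈_; _∉_; find; lose)
open import Data.List.Membership.Propositional.Properties using (∈-filter⁻; ∈-allFin; ∈-concatMap⁺)
open import Data.List.Membership.DecPropositional _≟_ using (_∈?_)
open import Data.List.Relation.Unary.Any using (Any; here; there)
import Data.List.Relation.Unary.Any.Properties as Any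
open import Data.List.Relation.Unary.All as All using (All; []; _∷_)
import Data.List.Relation.Unary.All.Properties as All
open import Data.List.Relation.Unary.AllPairs using (_∷_)
open import Data.List.Relation.Unary.Unique.Propositional using (Unique)
import Data.List.Relation.Unary.Unique.Propositional.Properties as Unique
open import Data.Product using (Σ; ∃; _×_; _,_; proj₁; proj₂)
open import Data.Unit using (⊤; tt)
open import Data.Empty using (⊥-elim)
open import Function using (_∘_)
open import Relation.Nullary using (Dec; yes; no; ¬?; contradiction)
open import Relation.Binary.PropositionalEquality
  using (_≡_; _≢_; refl; sym; trans; cong; cong₂; subst; subst₂; ≢-sym; module ≡-Reasoning)

∑-const : ∀ n c → ∑[ i < n ] c ≡ n * c
∑-const zero    c = refl
∑-const (suc n) c = cong (c +_) (∑-const n c)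

∑-mono-≤ : ∀ {n} {f g : Fin n → ℕ} → (∀ i → f i ≤ g i) → ∑[ i < n ] f i ≤ ∑[ i < n ] g i
∑-mono-≤ {zero}  _   = z≤n
∑-mono-≤ {suc n} f≤g = +-mono-≤ (f≤g zero) (∑-mono-≤ (f≤g ∘ suc))

term≤∑ : ∀ {n} (f : Fin n → ℕ) i → f i ≤ ∑[ j < n ] f j
term≤∑ f zero    = m≤m+n _ _
term≤∑ f (suc i) = ≤-trans (term≤∑ (f ∘ suc) i) (m≤n+m _ _)

∑<*⇒∃< : ∀ {n} (f : Fin n → ℕ) {t} → ∑[ i < n ] f i < n * t → ∃ λ i → f i < t
∑<*⇒∃< {suc n} f {t} ∑f<n*t with f zero <? t
... | yes f₀<t = zero , f₀<t
... | no  f₀≮t = let i , fᵢ<t = ∑<*⇒∃< (f ∘ suc) rest<n*t in suc i , fᵢ<t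
  where
  rest<n*t : ∑[ i < n ] f (suc i) < n * t
  rest<n*t = +-cancelˡ-< (f zero) _ _ (<-≤-trans ∑f<n*t (+-monoˡ-≤ (n * t) (≮⇒≥ f₀≮t)))

sum-tabulate : ∀ {n} (f : Fin n → ℕ) → ListAction.sum (tabulate f) ≡ ∑[ i < n ] f i
sum-tabulate {zero}  f = refl
sum-tabulate {suc n} f = cong (f zero +_) (sum-tabulate (f ∘ suc))

sum-map-allFin : ∀ {n} (f : Fin n → ℕ) →
  ListAction.sum (List.map f (allFin n)) ≡ ∑[ i < n ] f i
sum-map-allFin f = trans (cong ListAction.sum (map-tabulate (λ i → i) f)) (sum-tabulate f)

-- multichoose N j = C(N+j-1, j), the number of j-element multisets of N kinds
multichoose : ℕ → ℕ → ℕ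
multichoose N       zero    = 1
multichoose zero    (suc j) = 0
multichoose (suc N) (suc j) = multichoose N (suc j) + multichoose (suc N) j

multichoose-1 : ∀ N → multichoose N 1 ≡ N
multichoose-1 zero    = refl
multichoose-1 (suc N) = trans (cong (_+ 1) (multichoose-1 N)) (+-comm N 1)

suc*multichoose : ∀ N j → suc j * multichoose N (suc j) ≡ N * multichoose (suc N) j
suc*multichoose zero    j       = *-zeroʳ (suc j)
suc*multichoose (suc N) zero    =
  trans (+-identityʳ _) (trans (multichoose-1 (suc N)) (sym (*-identityʳ (suc N))))
suc*multichoose (suc N) (suc j) = begin
  (2 + j) * (X + Y)             ≡⟨ expand (suc j) X Y ⟩
  (2 + j) * X + (suc j * Y + Y) ≡⟨ cong₂ (λ u v → u + (v + Y)) (suc*multichoose N (suc j))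
                                                                (suc*multichoose (suc N) j) ⟩
  N * Y + (suc N * Z + Y)       ≡⟨ collect N Y Z ⟩
  suc N * (Y + Z)               ∎
  where
  open ≡-Reasoning
  X = multichoose N (2 + j)
  Y = multichoose (suc N) (suc j)
  Z = multichoose (2 + N) j
  expand : ∀ k X Y → (suc k) * (X + Y) ≡ suc k * X + (k * Y + Y)
  expand = solve-∀
  collect : ∀ N Y Z → N * Y + (suc N * Z + Y) ≡ suc N * (Y + Z)
  collect = solve-∀

^≤!*multichoose : ∀ j N → N ^ j ≤ j ! * multichoose N j
^≤!*multichoose zero    N = ≤-refl
^≤!*multichoose (suc j) N = begin
  N * N ^ j                             ≤⟨ *-monoʳ-≤ N (^-monoˡ-≤ j (n≤1+n N)) ⟩
  N * suc N ^ j                         ≤⟨ *-monoʳ-≤ N (^≤!*multichoose j (suc N)) ⟩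
  N * (j ! * multichoose (suc N) j)     ≡⟨ x∙yz≈y∙xz N (j !) _ ⟩
  j ! * (N * multichoose (suc N) j)     ≡⟨ cong (j ! *_) (sym (suc*multichoose N j)) ⟩
  j ! * (suc j * multichoose N (suc j)) ≡⟨ x∙yz≈yx∙z (j !) (suc j) _ ⟩
  suc j ! * multichoose N (suc j)       ∎
  where open ≤-Reasoning

^-distribʳ-* : ∀ m n j → (m * n) ^ j ≡ m ^ j * n ^ j
^-distribʳ-* m n zero    = refl
^-distribʳ-* m n (suc j) =
  trans (cong (m * n *_) (^-distribʳ-* m n j)) (interchange m n (m ^ j) (n ^ j))

s*x+p*y≤[s+p]*z : ∀ s p {x y z} → x ≤ z → y ≤ z → s * x + p * y ≤ (s + p) * z
s*x+p*y≤[s+p]*z s p {z = z} x≤z y≤z = begin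
  s * _ + p * _ ≤⟨ +-mono-≤ (*-monoʳ-≤ s x≤z) (*-monoʳ-≤ p y≤z) ⟩
  s * z + p * z ≡⟨ sym (*-distribʳ-+ z s p) ⟩
  (s + p) * z   ∎
  where open ≤-Reasoning

module NegativeBinomial (s p : ℕ) where

  -- negBinomial N J = (s+p)^J Σ_(j≤J) multichoose N j t^j with t = p/(s+p): a partial
  -- sum of the series of (1 - t)^(-N), scaled to be a natural number
  negBinomial : ℕ → ℕ → ℕ
  negBinomial N zero    = 1
  negBinomial N (suc J) = (s + p) * negBinomial N J + multichoose N (suc J) * p ^ suc J

  negBinomial-0 : ∀ J → negBinomial 0 J ≡ (s + p) ^ J
  negBinomial-0 zero    = refl
  negBinomial-0 (suc J) = trans (+-identityʳ _) (cong ((s + p) *_) (negBinomial-0 J))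

  negBinomial-pascal : ∀ N J →
    negBinomial (suc N) (suc J) ≡ negBinomial N (suc J) + p * negBinomial (suc N) J
  negBinomial-pascal N zero    = rearrange (s + p) (multichoose N 1) p
    where
    rearrange : ∀ a c p → a * 1 + (c + 1) * (p * 1) ≡ (a * 1 + c * (p * 1)) + p * 1
    rearrange = solve-∀
  negBinomial-pascal N (suc J) = begin
    a * T (suc N) (suc J) + (c₁ + c₂) * (p * p ^ suc J)
      ≡⟨ cong (λ t → a * t + (c₁ + c₂) * (p * p ^ suc J)) (negBinomial-pascal N J) ⟩
    a * (T N (suc J) + p * T (suc N) J) + (c₁ + c₂) * (p * p ^ suc J)
      ≡⟨ rearrange a (T N (suc J)) p (T (suc N) J) c₁ c₂ (p ^ suc J) ⟩
    (a * T N (suc J) + c₁ * (p * p ^ suc J)) + p * (a * T (suc N) J + c₂ * p ^ suc J) ∎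
    where
    open ≡-Reasoning
    a  = s + p
    T  = negBinomial
    c₁ = multichoose N (2 + J)
    c₂ = multichoose (suc N) (suc J)
    rearrange : ∀ a u p v x y q →
      a * (u + p * v) + (x + y) * (p * q) ≡ (a * u + x * (p * q)) + p * (a * v + y * q)
    rearrange = solve-∀

  -- For X ~ Bin(J+N, 1-t), s^N negBinomial N J / (s+p)^(J+N) = P(X ≥ N); when N ≥ 1 the
  -- disjoint event X = 0, of probability t^(J+N), can be added.
  s^N*negBinomial≤[s+p]^[J+N] : ∀ N J → s ^ N * negBinomial N J ≤ (s + p) ^ (J + N)
  s^N*negBinomial+p^[J+N]≤[s+p]^[J+N] : ∀ N J →
    s ^ suc N * negBinomial (suc N) J + p ^ (J + suc N) ≤ (s + p) ^ (J + suc N)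

  s^N*negBinomial≤[s+p]^[J+N] zero    J = ≤-reflexive (begin
    1 * negBinomial 0 J ≡⟨ *-identityˡ _ ⟩
    negBinomial 0 J     ≡⟨ negBinomial-0 J ⟩
    (s + p) ^ J         ≡⟨ cong ((s + p) ^_) (sym (+-identityʳ J)) ⟩
    (s + p) ^ (J + 0)   ∎)
    where open ≡-Reasoning
  s^N*negBinomial≤[s+p]^[J+N] (suc N) J =
    ≤-trans (m≤m+n _ _) (s^N*negBinomial+p^[J+N]≤[s+p]^[J+N] N J)

  s^N*negBinomial+p^[J+N]≤[s+p]^[J+N] N zero = begin
    s ^ suc N * 1 + p ^ suc N ≡⟨ cong (_+ p ^ suc N) (*-identityʳ _) ⟩
    s ^ suc N + p ^ suc N     ≤⟨ s*x+p*y≤[s+p]*z s p (^-monoˡ-≤ N (m≤m+n s p))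
                                                     (^-monoˡ-≤ N (m≤n+m p s)) ⟩
    (s + p) ^ suc N           ∎
    where open ≤-Reasoning
  s^N*negBinomial+p^[J+N]≤[s+p]^[J+N] N (suc J) = begin
    s ^ suc N * T (suc N) (suc J) + p * p ^ (J + suc N)
      ≡⟨ cong (λ t → s ^ suc N * t + p * p ^ (J + suc N)) (negBinomial-pascal N J) ⟩
    s * s ^ N * (T N (suc J) + p * T (suc N) J) + p * p ^ (J + suc N)
      ≡⟨ rearrange s (s ^ N) (T N (suc J)) p (T (suc N) J) (p ^ (J + suc N)) ⟩
    s * (s ^ N * T N (suc J)) + p * (s ^ suc N * T (suc N) J + p ^ (J + suc N))
      ≤⟨ s*x+p*y≤[s+p]*z s p
           (≤-trans (s^N*negBinomial≤[s+p]^[J+N] N (suc J))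
                    (≤-reflexive (cong ((s + p) ^_) (sym (+-suc J N)))))
           (s^N*negBinomial+p^[J+N]≤[s+p]^[J+N] N J) ⟩
    (s + p) * (s + p) ^ (J + suc N) ∎
    where
    open ≤-Reasoning
    T = negBinomial
    rearrange : ∀ s t u p v q →
      s * t * (u + p * v) + p * q ≡ s * (t * u) + p * (s * t * v + q)
    rearrange = solve-∀

  s^N*negBinomial<[s+p]^[J+N] : ∀ N J .{{_ : NonZero p}} .{{_ : NonZero N}} →
    s ^ N * negBinomial N J < (s + p) ^ (J + N)
  s^N*negBinomial<[s+p]^[J+N] (suc N) J =
    <-≤-trans (m<m+n _ (m^n>0 p (J + suc N))) (s^N*negBinomial+p^[J+N]≤[s+p]^[J+N] N J)

  expPartial*^≤!*negBinomial : ∀ {x N} → x * (s + p) ≡ N * p →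
    ∀ J → expPartial x J * (s + p) ^ J ≤ J ! * negBinomial N J
  expPartial*^≤!*negBinomial         _    zero    = ≤-refl
  expPartial*^≤!*negBinomial {x} {N} x*a≡N*p (suc J) = begin
    (suc J * E + x ^ suc J) * (a * a ^ J)          ≡⟨ expand (suc J) E x (x ^ J) a (a ^ J) ⟩
    suc J * a * (E * a ^ J) + x ^ suc J * a ^ suc J ≡⟨ cong (suc J * a * (E * a ^ J) +_) powers ⟩
    suc J * a * (E * a ^ J) + N ^ suc J * p ^ suc J
      ≤⟨ +-mono-≤ (*-monoʳ-≤ (suc J * a) (expPartial*^≤!*negBinomial x*a≡N*p J))
                  (*-monoˡ-≤ (p ^ suc J) (^≤!*multichoose (suc J) N)) ⟩
    suc J * a * (J ! * T J) + suc J ! * multichoose N (suc J) * p ^ suc J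
      ≡⟨ collect (suc J) a (J !) (T J) (multichoose N (suc J)) (p ^ suc J) ⟩
    suc J ! * T (suc J) ∎
    where
    open ≤-Reasoning
    a = s + p
    E = expPartial x J
    T = negBinomial N
    powers : x ^ suc J * a ^ suc J ≡ N ^ suc J * p ^ suc J
    powers = begin-equality
      x ^ suc J * a ^ suc J ≡⟨ sym (^-distribʳ-* x a (suc J)) ⟩
      (x * a) ^ suc J       ≡⟨ cong (_^ suc J) x*a≡N*p ⟩
      (N * p) ^ suc J       ≡⟨ ^-distribʳ-* N p (suc J) ⟩
      N ^ suc J * p ^ suc J ∎
    expand : ∀ j e x y a b → (j * e + x * y) * (a * b) ≡ j * a * (e * b) + x * y * (a * b)
    expand = solve-∀
    collect : ∀ j a f u c q → j * a * (f * u) + j * f * c * q ≡ j * f * (a * u + c * q)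
    collect = solve-∀

  ExpGe⇒X*s^N<[s+p]^N : ∀ {x N X} .{{_ : NonZero p}} .{{_ : NonZero N}} →
    x * (s + p) ≡ N * p → ExpGe x X → X * s ^ N < (s + p) ^ N
  ExpGe⇒X*s^N<[s+p]^N {x} {N} {X} x*a≡N*p (J , X*J!≤) = *-cancelʳ-< _ _ _ (begin-strict
    X * s ^ N * (J ! * a ^ J)        ≡⟨ rearrange X (s ^ N) (J !) (a ^ J) ⟩
    s ^ N * (X * J ! * a ^ J)        ≤⟨ *-monoʳ-≤ (s ^ N) (*-monoˡ-≤ (a ^ J) X*J!≤) ⟩
    s ^ N * (expPartial x J * a ^ J) ≤⟨ *-monoʳ-≤ (s ^ N) (expPartial*^≤!*negBinomial x*a≡N*p J) ⟩
    s ^ N * (J ! * negBinomial N J)  ≡⟨ x∙yz≈y∙xz (s ^ N) (J !) _ ⟩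
    J ! * (s ^ N * negBinomial N J)  <⟨ *-monoʳ-< (J !) {{J !≢0}}
                                                    (s^N*negBinomial<[s+p]^[J+N] N J) ⟩
    J ! * a ^ (J + N)                ≡⟨ cong (J ! *_) (^-distribˡ-+-* a J N) ⟩
    J ! * (a ^ J * a ^ N)            ≡⟨ x∙yz≈z∙xy (J !) (a ^ J) (a ^ N) ⟩
    a ^ N * (J ! * a ^ J)            ∎)
    where
    open ≤-Reasoning
    a = s + p
    rearrange : ∀ x y f b → x * y * (f * b) ≡ y * (x * f * b)
    rearrange = solve-∀

expPartial-0 : ∀ J → expPartial 0 J ≡ J !
expPartial-0 zero    = refl
expPartial-0 (suc J) = trans (+-identityʳ _) (cong (suc J *_) (expPartial-0 J))

ExpGe0⇒≤1 : ∀ {X} → ExpGe 0 X → X ≤ 1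
ExpGe0⇒≤1 {X} (J , X*J!≤) = *-cancelʳ-≤ X 1 (J !) {{J !≢0}}
  (≤-trans X*J!≤ (≤-reflexive (trans (expPartial-0 J) (sym (*-identityˡ (J !))))))

ExpGe⇒n*s^k<[s+p]^k : ∀ {n s p} k .{{_ : NonZero p}} → 2 ≤ n →
  ExpGe (k * p) (n ^ (s + p)) → n * s ^ k < (s + p) ^ k
ExpGe⇒n*s^k<[s+p]^k {n} {s} {p} zero 2≤n e⁰≥n^a =
  contradiction (ExpGe0⇒≤1 e⁰≥n^a)
                (<⇒≱ (^-monoʳ-< n 2≤n (<-≤-trans (>-nonZero⁻¹ p) (m≤n+m p s))))
ExpGe⇒n*s^k<[s+p]^k {n} {s} {p} k@(suc _) _ e^kp≥n^a =
  ≰⇒> (λ a^k≤n*s^k → <⇒≱ [n*s^k]^a<[a^k]^a (^-monoˡ-≤ a a^k≤n*s^k))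
  where
  a = s + p
  instance
    a≢0 : NonZero a
    a≢0 = >-nonZero (<-≤-trans (>-nonZero⁻¹ p) (m≤n+m p s))
    ka≢0 : NonZero (k * a)
    ka≢0 = m*n≢0 k a
  [n*s^k]^a<[a^k]^a : (n * s ^ k) ^ a < (a ^ k) ^ a
  [n*s^k]^a<[a^k]^a = subst₂ _<_
    (sym (trans (^-distribʳ-* n (s ^ k) a) (cong (n ^ a *_) (^-*-assoc s k a))))
    (sym (^-*-assoc a k a))
    (NegativeBinomial.ExpGe⇒X*s^N<[s+p]^N s p {N = k * a} {X = n ^ a} (xy∙z≈xz∙y k p a) e^kp≥n^a)

_≢?_ : (z c : ℕ) → Dec (z ≢ c)
z ≢? c = ¬? (z ≟ c)

remove : ℕ → List ℕ → List ℕ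
remove c = filter (_≢? c)

length-remove : ∀ {c cs} → Unique cs → c ∈ cs → suc (length (remove c cs)) ≡ length cs
length-remove {c} (c≢cs ∷ _) (here refl) =
  cong (suc ∘ length) (trans (filter-reject (_≢? c) (λ c≢c → c≢c refl))
                             (filter-all (_≢? c) (All.map ≢-sym c≢cs)))
length-remove {c} (z≢cs ∷ unique) (there c∈cs) =
  trans (cong (suc ∘ length) (filter-accept (_≢? c) (All.lookup z≢cs c∈cs)))
        (cong suc (length-remove unique c∈cs))

c∉remove : ∀ c cs → c ∉ remove c cs
c∉remove c cs c∈ = proj₂ (∈-filter⁻ (_≢? c) {xs = cs} c∈) refl

All∈-uncons : ∀ {c : ℕ} {C cs} → All (_∈ c ∷ C) cs → c ∉ cs → All (_∈ C) cs
All∈-uncons []                   _   = []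
All∈-uncons (here refl ∷ _)      c∉ = ⊥-elim (c∉ (here refl))
All∈-uncons (there z∈C ∷ cs⊆cC) c∉ = z∈C ∷ All∈-uncons cs⊆cC (c∉ ∘ there)

_[_↦_] : ∀ {A : Set} → (ℕ → A) → ℕ → A → ℕ → A
(x [ c ↦ y ]) z with z ≟ c
... | yes _ = y
... | no  _ = x z

[↦]-same : ∀ {A : Set} (x : ℕ → A) c y → (x [ c ↦ y ]) c ≡ y
[↦]-same x c y with c ≟ c
... | yes _   = refl
... | no  c≢c = contradiction refl c≢c

[↦]-other : ∀ {A : Set} (x : ℕ → A) {c z} y → z ≢ c → (x [ c ↦ y ]) z ≡ x z
[↦]-other x {c} {z} y z≢c with z ≟ c
... | yes z≡c = contradiction z≡c z≢c
... | no  _   = refl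

-- The state of a vertex while centres are chosen colour by colour: covered, or
-- pending cs e, where cs lists its colours whose centre is still to be chosen and e
-- counts its colours whose centre was chosen and is not adjacent to it.
data Status : Set where
  covered : Status
  pending : List ℕ → ℕ → Status

place : ℕ → Bool → Status → Status
place c hit covered = covered
place c hit (pending cs e) with c ∈? cs
... | no  _ = pending cs e
... | yes _ = if hit then covered else pending (remove c cs) (suc e)

data Valid (C : List ℕ) (E : ℕ) : Status → Set where
  covered : Valid C E covered
  pending : ∀ {cs e} → Unique cs → All (_∈ C) cs → e + length cs ≡ E →
            Valid C E (pending cs e)

place-valid : ∀ {c C E σ} hit → Valid (c ∷ C) E σ → Valid C E (place c hit σ)
place-valid hit covered = covered
place-valid {c} hit (pending {cs} {e} unique cs⊆cC e+|cs|≡E) with c ∈? cs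
... | no  c∉cs = pending unique (All∈-uncons cs⊆cC c∉cs) e+|cs|≡E
... | yes c∈cs with hit
...   | true  = covered
...   | false = pending (Unique.filter⁺ (_≢? c) unique)
                        (All∈-uncons (All.filter⁺ (_≢? c) cs⊆cC) (c∉remove c cs))
                        (trans (sym (+-suc e _))
                               (trans (cong (e +_) (length-remove unique c∈cs)) e+|cs|≡E))

misses : ∀ {m n} → (Fin m → Fin n → Bool) → Fin n → ℕ
misses {m} R u = ∑[ y < m ] (if R y u then 0 else 1)

module Hitting {m n : ℕ} (R : Fin m → Fin n → Bool) where

  Hit : (ℕ → Fin m) → Fin n → List ℕ → Set
  Hit x u cs = Any (λ c → R (x c) u ≡ true) cs

  Served : (ℕ → Fin m) → Fin n → Status → Set
  Served x u covered        = ⊤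
  Served x u (pending cs _) = Hit x u cs

  Hit-[↦] : ∀ {x c u cs} y → Hit x u cs → (∀ {z} → z ∈ cs → z ≢ c) → Hit (x [ c ↦ y ]) u cs
  Hit-[↦] {x} {u = u} y hit cs≢c =
    let z , z∈cs , xz~u = find hit
    in  lose z∈cs (trans (cong (λ t → R t u) ([↦]-other x y (cs≢c z∈cs))) xz~u)

  served-place : ∀ x c y u σ → Served x u (place c (R y u) σ) → Served (x [ c ↦ y ]) u σ
  served-place x c y u covered        _      = tt
  served-place x c y u (pending cs e) served with c ∈? cs
  ... | no  c∉cs = Hit-[↦] y served (λ z∈cs z≡c → c∉cs (subst (_∈ cs) z≡c z∈cs))
  ... | yes c∈cs with R y u in y~u
  ...   | true  = lose c∈cs (trans (cong (λ t → R t u) ([↦]-same x c y)) y~u)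
  ...   | false =
    Any.filter⁻ (_≢? c) (Hit-[↦] y served (λ z∈ → proj₂ (∈-filter⁻ (_≢? c) {xs = cs} z∈)))

  module _ (A B : ℕ) where

    -- With e + |cs| = E, the weight of pending cs e is B^E (A/B)^|cs|: B^E times a bound
    -- on the conditional probability that the vertex is never covered.
    weight : Status → ℕ
    weight covered        = 0
    weight (pending cs e) = A ^ length cs * B ^ e

    potential : (Fin n → Status) → ℕ
    potential σ = ∑[ u < n ] weight (σ u)

    place-average : (∀ u → misses R u * B ≤ m * A) → ∀ {C E} c u {σ} → Valid C E σ →
      ∑[ y < m ] weight (place c (R y u) σ) ≤ m * weight σ
    place-average _ c u covered = ≤-reflexive (∑-const m 0)
    place-average misses-rare c u (pending {cs} {e} unique _ _) with c ∈? cs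
    ... | no  _    = ≤-reflexive (∑-const m _)
    ... | yes c∈cs = begin
      ∑[ y < m ] weight (if R y u then covered else pending cs′ (suc e))
        ≡⟨ sum-cong-≗ (λ y → weight-if (R y u)) ⟩
      ∑[ y < m ] ((if R y u then 0 else 1) * K)
        ≡⟨ sym (*-distribʳ-sum K (λ y → if R y u then 0 else 1)) ⟩
      misses R u * K                            ≡⟨ rearrange (misses R u) B (A ^ length cs′) (B ^ e) ⟩
      misses R u * B * (A ^ length cs′ * B ^ e) ≤⟨ *-monoˡ-≤ _ (misses-rare u) ⟩
      m * A * (A ^ length cs′ * B ^ e)          ≡⟨ rearrange′ m A (A ^ length cs′) (B ^ e) ⟩
      m * (A ^ suc (length cs′) * B ^ e)        ≡⟨ cong (λ l → m * (A ^ l * B ^ e))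
                                                        (length-remove unique c∈cs) ⟩
      m * (A ^ length cs * B ^ e)               ∎
      where
      open ≤-Reasoning
      cs′ = remove c cs
      K = A ^ length cs′ * B ^ suc e
      weight-if : ∀ h →
        weight (if h then covered else pending cs′ (suc e)) ≡ (if h then 0 else 1) * K
      weight-if true  = refl
      weight-if false = sym (+-identityʳ K)
      rearrange : ∀ k b x y → k * (x * (b * y)) ≡ k * b * (x * y)
      rearrange = solve-∀
      rearrange′ : ∀ m a x y → m * a * (x * y) ≡ m * (a * x * y)
      rearrange′ = solve-∀

    served-at-end : ∀ {E σ} x u → Valid [] E σ → weight σ < B ^ E → Served x u σ
    served-at-end x u covered                         _ = tt
    served-at-end x u (pending {[]} {e} _ _ refl) 1*B^e<B^[e+0] =
      contradiction 1*B^e<B^[e+0]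
        (≤⇒≯ (≤-reflexive (trans (cong (B ^_) (+-identityʳ e)) (sym (*-identityˡ (B ^ e))))))
    served-at-end x u (pending _ (() ∷ _) _) _

    derandomise : .{{_ : NonZero m}} → (∀ u → misses R u * B ≤ m * A) →
      ∀ C E σ → (∀ u → Valid C E (σ u)) → potential σ < B ^ E →
      ∃ λ x → ∀ u → Served x u (σ u)
    derandomise _ [] E σ valid Φ<B^E =
      (λ _ → fromℕ< (>-nonZero⁻¹ m)) ,
      λ u → served-at-end _ u (valid u) (≤-<-trans (term≤∑ (weight ∘ σ) u) Φ<B^E)
    derandomise misses-rare (c ∷ C) E σ valid Φ<B^E =
      let y , Φ[σʸ]<B^E = ∑<*⇒∃< (potential ∘ σ′) average<m*B^E
          x , served    =
            derandomise misses-rare C E (σ′ y) (λ u → place-valid _ (valid u)) Φ[σʸ]<B^E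
      in  x [ c ↦ y ] , λ u → served-place x c y u (σ u) (served u)
      where
      open ≤-Reasoning
      σ′ : Fin m → Fin n → Status
      σ′ y u = place c (R y u) (σ u)
      average<m*B^E : ∑[ y < m ] potential (σ′ y) < m * B ^ E
      average<m*B^E = begin-strict
        ∑[ y < m ] ∑[ u < n ] weight (σ′ y u) ≡⟨ ∑-comm (λ y u → weight (σ′ y u)) ⟩
        ∑[ u < n ] ∑[ y < m ] weight (σ′ y u)
          ≤⟨ ∑-mono-≤ (λ u → place-average misses-rare c u (valid u)) ⟩
        ∑[ u < n ] (m * weight (σ u))        ≡⟨ sym (*-distribˡ-sum m (weight ∘ σ)) ⟩
        m * potential σ                      <⟨ *-monoʳ-< m Φ<B^E ⟩
        m * B ^ E                            ∎

    ∃-hitting-centres : .{{_ : NonZero m}} → (∀ u → misses R u * B ≤ m * A) →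
      ∀ {k} (L : Fin n → List ℕ) → (∀ u → Unique (L u)) → (∀ u → length (L u) ≡ k) →
      n * A ^ k < B ^ k → ∃ λ x → ∀ u → Hit x u (L u)
    ∃-hitting-centres misses-rare {k} L unique |L|≡k n*A^k<B^k =
      derandomise misses-rare (concatMap L (allFin n)) k (λ u → pending (L u) 0) valid Φ<B^k
      where
      valid : ∀ u → Valid (concatMap L (allFin n)) k (pending (L u) 0)
      valid u =
        pending (unique u) (All.tabulate (λ c∈ → ∈-concatMap⁺ L (lose (∈-allFin u) c∈))) (|L|≡k u)
      Φ<B^k : ∑[ u < n ] (A ^ length (L u) * 1) < B ^ k
      Φ<B^k = ≤-<-trans (≤-reflexive (begin-equality
        ∑[ u < n ] (A ^ length (L u) * 1)
          ≡⟨ sum-cong-≗ (λ u → cong (λ l → A ^ l * 1) (|L|≡k u)) ⟩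
        ∑[ u < n ] (A ^ k * 1)            ≡⟨ ∑-const n _ ⟩
        n * (A ^ k * 1)                   ≡⟨ cong (n *_) (*-identityʳ _) ⟩
        n * A ^ k                         ∎)) n*A^k<B^k
        where open ≤-Reasoning

open Hitting using (Hit; ∃-hitting-centres)

degree+misses≡n : ∀ {n} (G : Graph n) u → degree G u + misses (adj G) u ≡ n
degree+misses≡n {n} G u = begin
  degree G u + misses (adj G) u
    ≡⟨ cong (_+ misses (adj G) u) (sum-map-allFin (λ y → if adj G u y then 1 else 0)) ⟩
  ∑[ y < n ] (if adj G u y then 1 else 0) + ∑[ y < n ] (if adj G y u then 0 else 1)
    ≡⟨ sym (∑-distrib-+ (λ y → if adj G u y then 1 else 0) (λ y → if adj G y u then 0 else 1)) ⟩
  ∑[ y < n ] ((if adj G u y then 1 else 0) + (if adj G y u then 0 else 1))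
    ≡⟨ sum-cong-≗ adjacent-or-not ⟩
  ∑[ y < n ] 1 ≡⟨ ∑-const n 1 ⟩
  n * 1        ≡⟨ *-identityʳ n ⟩
  n            ∎
  where
  open ≡-Reasoning
  adjacent-or-not : ∀ y → (if adj G u y then 1 else 0) + (if adj G y u then 0 else 1) ≡ 1
  adjacent-or-not y rewrite Graph.sym G u y with adj G y u
  ... | true  = refl
  ... | false = refl

q*misses+p≤q*n : ∀ {n} p q (G : Graph n) → MinDegreeAtLeast G p q →
  ∀ u → q * misses (adj G) u + p ≤ q * n
q*misses+p≤q*n {n} p q G minDegree u = begin
  q * misses (adj G) u + p                ≤⟨ +-monoʳ-≤ _ (minDegree u) ⟩
  q * misses (adj G) u + q * degree G u   ≡⟨ sym (*-distribˡ-+ q _ _) ⟩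
  q * (misses (adj G) u + degree G u)     ≡⟨ cong (q *_) (trans (+-comm (misses (adj G) u) _)
                                                                (degree+misses≡n G u)) ⟩
  q * n                                   ∎
  where open ≤-Reasoning

centres⇒colouring : ∀ {n} (G : Graph n) → TriangleFree G →
  (L : Fin n → List ℕ) (x : ℕ → Fin n) → (∀ u → Hit (adj G) x u (L u)) →
  Σ (Fin n → ℕ) λ col → (∀ v → col v ∈ L v) × (∀ u v → adj G u v ≡ true → col u ≢ col v)
centres⇒colouring G triangleFree L x hit = col , col∈L , proper
  where
  col : Fin _ → ℕ
  col u = proj₁ (find (hit u))
  col∈L : ∀ u → col u ∈ L u
  col∈L u = proj₁ (proj₂ (find (hit u)))
  centre~ : ∀ u → adj G (x (col u)) u ≡ true
  centre~ u = proj₂ (proj₂ (find (hit u)))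
  proper : ∀ u v → adj G u v ≡ true → col u ≢ col v
  proper u v u~v col-u≡col-v =
    triangleFree (x (col u)) u v (centre~ u) u~v
                 (subst (λ c → adj G (x c) v ≡ true) (sym col-u≡col-v) (centre~ v))

corollary6p3 : (p q : ℕ) → 1 ≤ p → 1 ≤ q → (n : ℕ) → 1 ≤ n →
    (G : Graph n) → TriangleFree G → MinDegreeAtLeast G p q →
    (k : ℕ) → CeilLogBound n p q k → ListChromaticAtMost G k
corollary6p3 p q 1≤p _ (suc zero) _ G _ minDegree _ _ =
  contradiction (≤-trans (minDegree zero) (≤-reflexive (trans (cong (q *_) isolated) (*-zeroʳ q))))
                (<⇒≱ 1≤p)
  where
  isolated : degree G zero ≡ 0
  isolated = cong (λ b → (if b then 1 else 0) + 0) (irref G zero)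
corollary6p3 p q 1≤p _ n@(suc (suc _)) _ G triangleFree minDegree k (e^kp≥n^qn , _) L lists =
  let x , hit = ∃-hitting-centres (adj G) s (q * n) misses-rare L (proj₂ ∘ lists) (proj₁ ∘ lists)
                                  n*s^k<[qn]^k
  in  centres⇒colouring G triangleFree L x hit
  where
  instance
    p≢0 : NonZero p
    p≢0 = >-nonZero 1≤p
  s = q * n ∸ p
  s+p≡qn : s + p ≡ q * n
  s+p≡qn = m∸n+n≡m (≤-trans (m≤n+m p _) (q*misses+p≤q*n p q G minDegree zero))
  misses-rare : ∀ u → misses (adj G) u * (q * n) ≤ n * s
  misses-rare u = ≤-trans (≤-reflexive (x∙yz≈z∙yx (misses (adj G) u) q n))
    (*-monoʳ-≤ n (m+n≤o⇒m≤o∸n (q * misses (adj G) u) (q*misses+p≤q*n p q G minDegree u)))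
  n*s^k<[qn]^k : n * s ^ k < (q * n) ^ k
  n*s^k<[qn]^k = subst (λ a → n * s ^ k < a ^ k) s+p≡qn
    (ExpGe⇒n*s^k<[s+p]^k k (s≤s (s≤s z≤n))
                         (subst (λ a → ExpGe (k * p) (n ^ a)) (sym s+p≡qn) e^kp≥n^qn))
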